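{- Let $\mu=(m,n)$ be a triangular $2$-partition and $\theta$ the $i$-row-regular tableau on $\mu$. Let $k>0$, $\lambda=(m+k,n)$, and let $\theta'$ be the tableau on $\lambda$ extending $\theta$ by labeling the $k$ extra cells of the bottom row with $m+n+1,m+n+2,\dots,m+n+k$. Then $\lambda$ is a triangular partition and $\theta'$ is the $i$-row-regular tableau on $\lambda$.
   Context: A $2$-partition $(m,n)$ has $m\ge n\ge0$: a bottom row of $m$ cells and an upper row of $n$ cells (French convention). A partition is triangular if there exist positive reals $r,s$ with $\lambda_j=\lfloor r-jr/s\rfloor$ for integers $1\le j\le s$ and $\lambda_j=0$ for $j>s$. For a triangular $2$-partition $(m,n)$ and $1\le i\le m-2(n-1)$, the $i$-row-regular tableau is the standard Young tableau whose upper-row labels are $n+i,n+i+2,\dots,n+i+2(n-1)$ (the bottom row contains the other labels in increasing order).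
   Formalization: The parameters $r,s$ witnessing that a partition is triangular range over the positive rationals instead of the positive reals. -}

module Defs where

open import Data.Nat as ℕ using (ℕ; zero; suc; _+_; _*_; _≤_; _<_)
open import Data.Integer as ℤ using (ℤ; +_)
open import Data.Rational as ℚ using (ℚ; floor; Positive; NonZero; _÷_)
open import Data.Rational.Properties using (pos⇒nonZero)
open import Data.Fin using (Fin; toℕ; splitAt)
open import Data.Sum using (_⊎_; inj₁; inj₂)
open import Data.Product using (Σ; _×_)
open import Function.Definitions using (Injective)
open import Relation.Binary.PropositionalEquality using (_≡_)

toℚ : ℕ → ℚ
toℚ j = (+ j) ℚ./ 1

part : ℕ → ℕ → ℕ → ℕ
part m n 1 = m
part m n 2 = n
part m n _ = 0

TriCond : ℕ → ℕ → (r s : ℚ) → .{{NonZero s}} → Set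
TriCond m n r s =
  (j : ℕ) → 1 ≤ j →
    ((toℚ j ℚ.≤ s → + part m n j ≡ floor (r ℚ.- (toℚ j ℚ.* r) ÷ s))
    × (s ℚ.< toℚ j → part m n j ≡ 0))

-- The 2-partition (m , n) is triangular: there are positive r, s with the above.
-- (Real parameters are replaced by rational ones.)
Triangular : ℕ → ℕ → Set
Triangular m n =
  Σ ℚ λ r → Σ ℚ λ s → Σ (Positive r) λ _ → Σ (Positive s) λ ps →
    TriCond m n r s {{pos⇒nonZero s {{ps}}}}

-- A filling of the shape (m , n): inj₁ a is the bottom-row cell in column a,
-- inj₂ b is the upper-row cell in column b.
Tableau : ℕ → ℕ → Set
Tableau m n = Fin m ⊎ Fin n → ℕ

-- Standard Young tableau of shape (m , n) (French convention, n ≤ m):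
-- labels are exactly 1 , … , m + n (each once), rows increase left to right,
-- columns increase bottom to top.
Standard : (m n : ℕ) → Tableau m n → Set
Standard m n T =
    ((c : Fin m ⊎ Fin n) → 1 ≤ T c × T c ≤ m + n)
  × Injective _≡_ _≡_ T
  × ((a a' : Fin m) → toℕ a < toℕ a' → T (inj₁ a) < T (inj₁ a'))
  × ((b b' : Fin n) → toℕ b < toℕ b' → T (inj₂ b) < T (inj₂ b'))
  × ((a : Fin m) (b : Fin n) → toℕ a ≡ toℕ b → T (inj₁ a) < T (inj₂ b))

-- T is the i-row-regular tableau on (m , n): a standard Young tableau whose
-- upper-row labels are n+i, n+i+2, …, n+i+2(n-1) (the bottom row then holds the
-- remaining labels in increasing order, by standardness).
RowRegular : (m n i : ℕ) → Tableau m n → Set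
RowRegular m n i T =
  Standard m n T × ((b : Fin n) → T (inj₂ b) ≡ n + i + 2 * toℕ b)

-- Range condition 1 ≤ i ≤ m - 2(n-1) (integer arithmetic), i.e. 1 ≤ i and i + 2n ≤ m + 2.
InRange : (m n i : ℕ) → Set
InRange m n i = 1 ≤ i × i + 2 * n ≤ m + 2

extend : {m n : ℕ} (k : ℕ) → Tableau m n → Tableau (m + k) n
extend {m} {n} k T (inj₁ a) with splitAt m a
... | inj₁ a' = T (inj₁ a')
... | inj₂ e  = m + n + suc (toℕ e)
extend k T (inj₂ b) = T (inj₂ b)

{-# OPTIONS --safe #-}
-- A 2-partition (n + D, n) with 0 < D and n ≤ D is triangular: take r = n + 2D and
-- s = r / D, so that r - j r / s = r - j D is an integer and equals n + D, n and, when
-- j = 3 ≤ s (which forces n = D), 0; beyond s the parts vanish because j D > r.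
-- The range condition gives 2n ≤ m + 1 ≤ m + k, so (m + k, n) has this form. The extended tableau stays standard
-- because the new labels exceed all old ones and the new cells lie beyond the upper
-- row; the upper row, hence row regularity, is untouched.
module Submission where

open import Defs
open import Data.Nat using (ℕ; suc; _+_; _*_; _∸_; _≤_; _<_; z≤n; s≤s)
import Data.Nat as ℕ
import Data.Nat.Properties as ℕP
import Data.Nat.DivMod as ℕD
open import Data.Nat.Coprimality as C using ()
open import Data.Integer as ℤ using (+_)
import Data.Integer.Properties as ℤP
open import Data.Rational as ℚ using (ℚ; mkℚ; floor; Positive; NonZero; _÷_; 1/_)
import Data.Rational.Properties as ℚP
open import Data.Fin using (Fin; toℕ; splitAt; _↑ˡ_; _↑ʳ_)
import Data.Fin.Properties as FinP
open import Data.Sum using (_⊎_; inj₁; inj₂; map₁)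
open import Data.Product using (_×_; _,_; proj₁; proj₂)
open import Function using (_∘_)
open import Function.Definitions using (Injective)
open import Relation.Nullary using (contradiction)
open import Relation.Binary.PropositionalEquality

toℚ≡mkℚ : ∀ a → toℚ a ≡ mkℚ (+ a) 0 (C.sym (C.1-coprimeTo a))
toℚ≡mkℚ a = ℚP.normalize-coprime _

floor-toℚ : ∀ a → floor (toℚ a) ≡ + a
floor-toℚ a rewrite toℚ≡mkℚ a = trans (ℤP.*-identityˡ _) (cong +_ (ℕD.n/1≡n a))

toℚ-homo-+ : ∀ a b → toℚ (a + b) ≡ toℚ a ℚ.+ toℚ b
toℚ-homo-+ a b rewrite toℚ≡mkℚ a | toℚ≡mkℚ b =
  cong (ℚ._/ 1) (sym (cong₂ ℤ._+_ (ℤP.*-identityʳ (+ a)) (ℤP.*-identityʳ (+ b))))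

toℚ-homo-* : ∀ a b → toℚ (a * b) ≡ toℚ a ℚ.* toℚ b
toℚ-homo-* a b rewrite toℚ≡mkℚ a | toℚ≡mkℚ b = cong (ℚ._/ 1) (ℤP.pos-* a b)

toℚ-homo-∸ : ∀ {a b} → b ≤ a → toℚ (a ∸ b) ≡ toℚ a ℚ.- toℚ b
toℚ-homo-∸ {a} {b} b≤a = begin
  toℚ (a ∸ b)                            ≡⟨ ℚP.+-identityʳ (toℚ (a ∸ b)) ⟨
  toℚ (a ∸ b) ℚ.+ ℚ.0ℚ                   ≡⟨ cong (toℚ (a ∸ b) ℚ.+_) (ℚP.+-inverseʳ (toℚ b)) ⟨
  toℚ (a ∸ b) ℚ.+ (toℚ b ℚ.- toℚ b)      ≡⟨ ℚP.+-assoc (toℚ (a ∸ b)) (toℚ b) (ℚ.- toℚ b) ⟨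
  (toℚ (a ∸ b) ℚ.+ toℚ b) ℚ.- toℚ b      ≡⟨ cong (ℚ._- toℚ b) (toℚ-homo-+ (a ∸ b) b) ⟨
  toℚ (a ∸ b + b) ℚ.- toℚ b              ≡⟨ cong (λ x → toℚ x ℚ.- toℚ b) (ℕP.m∸n+n≡m b≤a) ⟩
  toℚ a ℚ.- toℚ b                        ∎
  where open ≡-Reasoning

toℚ-mono-≤ : ∀ {a b} → a ≤ b → toℚ a ℚ.≤ toℚ b
toℚ-mono-≤ {a} {b} a≤b rewrite toℚ≡mkℚ a | toℚ≡mkℚ b =
  ℚ.*≤* (subst₂ ℤ._≤_ (sym (ℤP.*-identityʳ (+ a))) (sym (ℤP.*-identityʳ (+ b))) (ℤ.+≤+ a≤b))

toℚ-cancel-≤ : ∀ {a b} → toℚ a ℚ.≤ toℚ b → a ≤ b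
toℚ-cancel-≤ {a} {b} a≤b rewrite toℚ≡mkℚ a | toℚ≡mkℚ b =
  ℤP.drop‿+≤+ (subst₂ ℤ._≤_ (ℤP.*-identityʳ (+ a)) (ℤP.*-identityʳ (+ b)) (ℚP.drop-*≤* a≤b))

toℚ-pos : ∀ a .{{_ : ℕ.NonZero a}} → Positive (toℚ a)
toℚ-pos a = ℚP.normalize-pos a 1

÷-*-cancel : ∀ x y .{{_ : NonZero y}} → (x ÷ y) ℚ.* y ≡ x
÷-*-cancel x y = begin
  x ℚ.* 1/ y ℚ.* y     ≡⟨ ℚP.*-assoc x (1/ y) y ⟩
  x ℚ.* (1/ y ℚ.* y)   ≡⟨ cong (x ℚ.*_) (ℚP.*-inverseˡ y) ⟩
  x ℚ.* ℚ.1ℚ           ≡⟨ ℚP.*-identityʳ x ⟩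
  x                    ∎
  where open ≡-Reasoning

*-÷-cancelˡ : ∀ x y .{{_ : NonZero y}} → (y ℚ.* x) ÷ y ≡ x
*-÷-cancelˡ x y = begin
  (y ℚ.* x) ÷ y   ≡⟨ cong (_÷ y) (ℚP.*-comm y x) ⟩
  (x ℚ.* y) ÷ y   ≡⟨ ℚP.*-assoc x y (1/ y) ⟩
  x ℚ.* (y ÷ y)   ≡⟨ cong (x ℚ.*_) (ℚP.*-inverseʳ y) ⟩
  x ℚ.* ℚ.1ℚ      ≡⟨ ℚP.*-identityʳ x ⟩
  x               ∎
  where open ≡-Reasoning

÷-÷-cancel : ∀ x y .{{_ : NonZero y}} .{{_ : NonZero (x ÷ y)}} → x ÷ (x ÷ y) ≡ y
÷-÷-cancel x y = trans (cong (_÷ (x ÷ y)) (sym (÷-*-cancel x y))) (*-÷-cancelˡ y (x ÷ y))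

≤-÷⇒*-≤ : ∀ {x y} z .{{_ : Positive z}} .{{_ : NonZero z}} → x ℚ.≤ y ÷ z → x ℚ.* z ℚ.≤ y
≤-÷⇒*-≤ {y = y} z x≤y÷z =
  subst (_ ℚ.≤_) (÷-*-cancel y z) (ℚP.*-monoʳ-≤-nonNeg z {{ℚP.pos⇒nonNeg z}} x≤y÷z)

*-≤⇒≤-÷ : ∀ {x y} z .{{_ : Positive z}} .{{_ : NonZero z}} → x ℚ.* z ℚ.≤ y → x ℚ.≤ y ÷ z
*-≤⇒≤-÷ {y = y} z xz≤y = ℚP.*-cancelʳ-≤-pos z (subst (_ ℚ.≤_) (sym (÷-*-cancel y z)) xz≤y)

module LinearProfile (T D : ℕ) .{{_ : ℕ.NonZero T}} .{{_ : ℕ.NonZero D}} where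

  instance
    D>0 : Positive (toℚ D)
    D>0 = toℚ-pos D
    D≢0 : NonZero (toℚ D)
    D≢0 = ℚP.pos⇒nonZero (toℚ D)

  r s : ℚ
  r = toℚ T
  s = r ÷ toℚ D

  instance
    r>0 : Positive r
    r>0 = toℚ-pos T
    s>0 : Positive s
    s>0 = ℚP.pos*pos⇒pos r (1/ toℚ D) {{ℚP.1/pos⇒pos (toℚ D)}}
    s≢0 : NonZero s
    s≢0 = ℚP.pos⇒nonZero s

  profile : ∀ j → j * D ≤ T → r ℚ.- (toℚ j ℚ.* r) ÷ s ≡ toℚ (T ∸ j * D)
  profile j jD≤T = begin
    r ℚ.- (toℚ j ℚ.* r) ÷ s       ≡⟨ cong (λ x → r ℚ.- x) (ℚP.*-assoc (toℚ j) r (1/ s)) ⟩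
    r ℚ.- toℚ j ℚ.* (r ÷ s)       ≡⟨ cong (λ x → r ℚ.- toℚ j ℚ.* x) (÷-÷-cancel r (toℚ D)) ⟩
    r ℚ.- toℚ j ℚ.* toℚ D         ≡⟨ cong (λ x → r ℚ.- x) (toℚ-homo-* j D) ⟨
    toℚ T ℚ.- toℚ (j * D)         ≡⟨ toℚ-homo-∸ jD≤T ⟨
    toℚ (T ∸ j * D)               ∎
    where open ≡-Reasoning

  ≤s⇒*D≤T : ∀ j → toℚ j ℚ.≤ s → j * D ≤ T
  ≤s⇒*D≤T j j≤s = toℚ-cancel-≤ (subst (ℚ._≤ r) (sym (toℚ-homo-* j D)) (≤-÷⇒*-≤ (toℚ D) j≤s))

  *D≤T⇒≤s : ∀ j → j * D ≤ T → toℚ j ℚ.≤ s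
  *D≤T⇒≤s j jD≤T = *-≤⇒≤-÷ (toℚ D) (subst (ℚ._≤ r) (toℚ-homo-* j D) (toℚ-mono-≤ jD≤T))

  triCond : ∀ {m n} → (∀ j → 1 ≤ j → part m n j ≡ T ∸ j * D) → TriCond m n r s
  triCond part≡ j 1≤j = on-range , beyond-range
    where
    on-range : toℚ j ℚ.≤ s → + part _ _ j ≡ floor (r ℚ.- (toℚ j ℚ.* r) ÷ s)
    on-range j≤s = begin
      + part _ _ j                       ≡⟨ cong +_ (part≡ j 1≤j) ⟩
      + (T ∸ j * D)                      ≡⟨ floor-toℚ (T ∸ j * D) ⟨
      floor (toℚ (T ∸ j * D))            ≡⟨ cong floor (profile j (≤s⇒*D≤T j j≤s)) ⟨
      floor (r ℚ.- (toℚ j ℚ.* r) ÷ s)    ∎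
      where open ≡-Reasoning
    beyond-range : s ℚ.< toℚ j → part _ _ j ≡ 0
    beyond-range s<j = trans (part≡ j 1≤j) (ℕP.m≤n⇒m∸n≡0 (ℕP.≰⇒≥ λ jD≤T →
      ℚP.<-irrefl refl (ℚP.<-≤-trans s<j (*D≤T⇒≤s j jD≤T))))

  triangular : ∀ {m n} → (∀ j → 1 ≤ j → part m n j ≡ T ∸ j * D) → Triangular m n
  triangular part≡ = r , s , r>0 , s>0 , triCond part≡

triangular-+ : ∀ n D .{{_ : ℕ.NonZero D}} → n ≤ D → Triangular (n + D) n
triangular-+ n D n≤D = LinearProfile.triangular (n + D + D) D {{T≢0}} part≡
  where
  open ≡-Reasoning
  T≢0 : ℕ.NonZero (n + D + D)
  T≢0 = ℕ.>-nonZero (ℕP.<-≤-trans (ℕ.>-nonZero⁻¹ D) (ℕP.m≤n+m D (n + D)))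
  part≡ : ∀ j → 1 ≤ j → part (n + D) n j ≡ n + D + D ∸ j * D
  part≡ 1 _ = sym (begin
    n + D + D ∸ 1 * D        ≡⟨ cong (n + D + D ∸_) (ℕP.*-identityˡ D) ⟩
    n + D + D ∸ D            ≡⟨ ℕP.m+n∸n≡m (n + D) D ⟩
    n + D                    ∎)
  part≡ 2 _ = sym (begin
    n + D + D ∸ (D + (D + 0)) ≡⟨ cong (λ x → n + D + D ∸ (D + x)) (ℕP.+-identityʳ D) ⟩
    n + D + D ∸ (D + D)       ≡⟨ ℕP.∸-+-assoc (n + D + D) D D ⟨
    n + D + D ∸ D ∸ D         ≡⟨ cong (_∸ D) (ℕP.m+n∸n≡m (n + D) D) ⟩
    n + D ∸ D                 ≡⟨ ℕP.m+n∸n≡m n D ⟩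
    n                         ∎)
  part≡ (suc (suc (suc j))) _ = sym (ℕP.m≤n⇒m∸n≡0 T≤[3+j]D)
    where
    T≤[3+j]D : n + D + D ≤ (3 + j) * D
    T≤[3+j]D = subst (_≤ (3 + j) * D) (ℕP.+-comm D (n + D))
      (ℕP.+-monoʳ-≤ D (ℕP.+-mono-≤ n≤D (ℕP.m≤m+n D (j * D))))

triangular : ∀ {m n} → n < m → 2 * n ≤ m → Triangular m n
triangular {m} {n} n<m 2n≤m =
  subst (λ m → Triangular m n) (ℕP.m+[n∸m]≡n (ℕP.<⇒≤ n<m))
    (triangular-+ n (m ∸ n) {{ℕ.>-nonZero (ℕP.m<n⇒0<n∸m n<m)}} n≤m∸n)
  where
  n≤m∸n : n ≤ m ∸ n
  n≤m∸n = subst (_≤ m ∸ n) (ℕP.m+n∸n≡m n n)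
    (ℕP.∸-monoˡ-≤ n (subst (_≤ m) (cong (λ x → n + x) (ℕP.+-identityʳ n)) 2n≤m))

data SplitView (m k : ℕ) : Fin (m + k) → Set where
  inˡ : (a : Fin m) → SplitView m k (a ↑ˡ k)
  inʳ : (e : Fin k) → SplitView m k (m ↑ʳ e)

splitView : ∀ m k (a : Fin (m + k)) → SplitView m k a
splitView m k a with splitAt m a in eq
... | inj₁ a′ = subst (SplitView m k) (FinP.splitAt⁻¹-↑ˡ eq) (inˡ a′)
... | inj₂ e  = subst (SplitView m k) (FinP.splitAt⁻¹-↑ʳ eq) (inʳ e)

m≤toℕ-↑ʳ : ∀ m {k} (e : Fin k) → m ≤ toℕ (m ↑ʳ e)
m≤toℕ-↑ʳ m e = subst (m ≤_) (sym (FinP.toℕ-↑ʳ m e)) (ℕP.m≤m+n m (toℕ e))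

toℕ-↑ˡ<toℕ-↑ʳ : ∀ {m k} (a : Fin m) (e : Fin k) → toℕ (a ↑ˡ k) < toℕ (m ↑ʳ e)
toℕ-↑ˡ<toℕ-↑ʳ {m} {k} a e =
  ℕP.<-≤-trans (subst (_< m) (sym (FinP.toℕ-↑ˡ a k)) (FinP.toℕ<n a)) (m≤toℕ-↑ʳ m e)

BottomRowIncreasing : ∀ {m n} → Tableau m n → Set
BottomRowIncreasing {m} T = (a a′ : Fin m) → toℕ a < toℕ a′ → T (inj₁ a) < T (inj₁ a′)

ColumnsIncreasing : ∀ {m n} → Tableau m n → Set
ColumnsIncreasing {m} {n} T = (a : Fin m) (b : Fin n) → toℕ a ≡ toℕ b → T (inj₁ a) < T (inj₂ b)

module Extension {m n : ℕ} (k : ℕ) (θ : Tableau m n) where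

  E : Tableau (m + k) n
  E = extend k θ

  newLabel : Fin k → ℕ
  newLabel e = m + n + suc (toℕ e)

  embed : Fin m ⊎ Fin n → Fin (m + k) ⊎ Fin n
  embed = map₁ (_↑ˡ k)

  data CellView : Fin (m + k) ⊎ Fin n → Set where
    old   : (c : Fin m ⊎ Fin n) → CellView (embed c)
    added : (e : Fin k) → CellView (inj₁ (m ↑ʳ e))

  cellView : ∀ c → CellView c
  cellView (inj₂ b) = old (inj₂ b)
  cellView (inj₁ a) with splitView m k a
  ... | inˡ a′ = old (inj₁ a′)
  ... | inʳ e  = added e

  extend-↑ˡ : ∀ a → E (inj₁ (a ↑ˡ k)) ≡ θ (inj₁ a)
  extend-↑ˡ a rewrite FinP.splitAt-↑ˡ m a k = refl

  extend-↑ʳ : ∀ e → E (inj₁ (m ↑ʳ e)) ≡ newLabel e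
  extend-↑ʳ e rewrite FinP.splitAt-↑ʳ m k e = refl

  extend-embed : ∀ c → E (embed c) ≡ θ c
  extend-embed (inj₁ a) = extend-↑ˡ a
  extend-embed (inj₂ b) = refl

  module _ (θ≤m+n : ∀ c → θ c ≤ m + n) where

    old<added : ∀ c e → E (embed c) < E (inj₁ (m ↑ʳ e))
    old<added c e rewrite extend-embed c | extend-↑ʳ e =
      ℕP.≤-<-trans (θ≤m+n c) (ℕP.m<m+n (m + n) ℕ.z<s)

    extend-bounded : (∀ c → 1 ≤ θ c) → ∀ c → 1 ≤ E c × E c ≤ m + k + n
    extend-bounded 1≤θ c with cellView c
    ... | old c′   rewrite extend-embed c′ = 1≤θ c′ , ℕP.≤-trans (θ≤m+n c′) m+n≤m+k+n
      where
      m+n≤m+k+n : m + n ≤ m + k + n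
      m+n≤m+k+n = ℕP.+-monoˡ-≤ n (ℕP.m≤m+n m k)
    ... | added e  rewrite extend-↑ʳ e = ℕP.≤-trans (s≤s z≤n) (ℕP.m≤n+m (suc (toℕ e)) (m + n)) , new≤
      where
      new≤ : newLabel e ≤ m + k + n
      new≤ = begin
        m + n + suc (toℕ e)  ≤⟨ ℕP.+-monoʳ-≤ (m + n) (FinP.toℕ<n e) ⟩
        m + n + k            ≡⟨ ℕP.+-assoc m n k ⟩
        m + (n + k)          ≡⟨ cong (λ x → m + x) (ℕP.+-comm n k) ⟩
        m + (k + n)          ≡⟨ ℕP.+-assoc m k n ⟨
        m + k + n            ∎
        where open ℕP.≤-Reasoning

    extend-injective : Injective _≡_ _≡_ θ → Injective _≡_ _≡_ E
    extend-injective θ-inj {x} {y} Ex≡Ey with cellView x | cellView y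
    ... | old c   | old c′   =
      cong embed (θ-inj (trans (sym (extend-embed c)) (trans Ex≡Ey (extend-embed c′))))
    ... | old c   | added e  = contradiction Ex≡Ey (ℕP.<⇒≢ (old<added c e))
    ... | added e | old c    = contradiction (sym Ex≡Ey) (ℕP.<⇒≢ (old<added c e))
    ... | added e | added e′ = cong (λ e → inj₁ (m ↑ʳ e)) (FinP.toℕ-injective
      (ℕP.suc-injective (ℕP.+-cancelˡ-≡ (m + n) _ _
        (trans (sym (extend-↑ʳ e)) (trans Ex≡Ey (extend-↑ʳ e′))))))

    extend-bottomRowIncreasing : BottomRowIncreasing θ → BottomRowIncreasing E
    extend-bottomRowIncreasing θ< a a′ a<a′ with splitView m k a | splitView m k a′
    ... | inˡ b | inˡ b′ = subst₂ _<_ (sym (extend-↑ˡ b)) (sym (extend-↑ˡ b′))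
      (θ< b b′ (subst₂ _<_ (FinP.toℕ-↑ˡ b k) (FinP.toℕ-↑ˡ b′ k) a<a′))
    ... | inˡ b | inʳ e  = old<added (inj₁ b) e
    ... | inʳ e | inˡ b  = contradiction a<a′ (ℕP.<-asym (toℕ-↑ˡ<toℕ-↑ʳ b e))
    ... | inʳ e | inʳ e′ = subst₂ _<_ (sym (extend-↑ʳ e)) (sym (extend-↑ʳ e′))
      (ℕP.+-monoʳ-< (m + n) (ℕ.s<s (ℕP.+-cancelˡ-< m _ _
        (subst₂ _<_ (FinP.toℕ-↑ʳ m e) (FinP.toℕ-↑ʳ m e′) a<a′))))

  extend-columnsIncreasing : n ≤ m → ColumnsIncreasing θ → ColumnsIncreasing E
  extend-columnsIncreasing n≤m θ< a b a≡b with splitView m k a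
  ... | inˡ a′ = subst (_< θ (inj₂ b)) (sym (extend-↑ˡ a′))
    (θ< a′ b (trans (sym (FinP.toℕ-↑ˡ a′ k)) a≡b))
  ... | inʳ e  = contradiction (subst (_< n) (sym a≡b) (FinP.toℕ<n b))
    (ℕP.≤⇒≯ (ℕP.≤-trans n≤m (m≤toℕ-↑ʳ m e)))

extend-standard : ∀ {m n} k {θ : Tableau m n} → n ≤ m → Standard m n θ →
  Standard (m + k) n (extend k θ)
extend-standard k {θ} n≤m (bounded , injective , bottom< , top< , columns<) =
  extend-bounded θ≤m+n (proj₁ ∘ bounded) ,
  extend-injective θ≤m+n injective ,
  extend-bottomRowIncreasing θ≤m+n bottom< ,
  top< ,
  extend-columnsIncreasing n≤m columns<
  where
  open Extension k θ
  θ≤m+n = proj₂ ∘ bounded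

lemma4p7 : (m n i k : ℕ) → n ≤ m → Triangular m n → InRange m n i →
    (θ : Tableau m n) → RowRegular m n i θ → 0 < k →
    Triangular (m Data.Nat.+ k) n × InRange (m Data.Nat.+ k) n i
      × RowRegular (m Data.Nat.+ k) n i (extend k θ)
lemma4p7 m n i k n≤m _ (1≤i , i+2n≤m+2) θ (standard , upper) 0<k =
  triangular n<m+k 2n≤m+k ,
  (1≤i , ℕP.≤-trans i+2n≤m+2 (ℕP.+-monoˡ-≤ 2 (ℕP.m≤m+n m k))) ,
  (extend-standard k n≤m standard , upper)
  where
  n<m+k : n < m + k
  n<m+k = ℕP.≤-<-trans n≤m (ℕP.m<m+n m 0<k)
  2n≤m+k : 2 * n ≤ m + k
  2n≤m+k = ℕP.≤-pred (begin
    suc (2 * n)  ≤⟨ ℕP.+-monoˡ-≤ (2 * n) 1≤i ⟩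
    i + 2 * n    ≤⟨ i+2n≤m+2 ⟩
    m + 2        ≤⟨ ℕP.+-monoʳ-≤ m (s≤s 0<k) ⟩
    m + suc k    ≡⟨ ℕP.+-suc m k ⟩
    suc (m + k)  ∎)
    where open ℕP.≤-Reasoning
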